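{- Let $(S,U,A,C)$ be a workflow schema where all constraints are regular and intersection-closed, and where every singleton $\{s\}$, $s\in S$, is $c$-eligible for every constraint $c\in C$. Let $M\subseteq U$ be the set of marked users produced by the marking procedure described below. Then there is a valid plan for the instance if and only if there is a valid plan using only users from $M$.
   Context: A workflow schema is $(S,U,A,C)$: tasks $S$, users $U$, authorization lists $A\colon S\to 2^U$, constraints $C$. A constraint is $c=(L,\Theta)$, $L\subseteq S$, $\Theta$ a set of functions $L\to U$. A plan $\pi\colon S\to U$ is valid if $\pi(s)\in A(s)$ for all $s$ and $\pi|_L\in\Theta$ for all constraints. For $\pi\colon L\to U$, $L/\pi$ is the partition of $L$ into classes of tasks receiving the same user; $T\subseteq L$ is $c$-eligible if some $\pi\in\Theta$ has $T\in L/\pi$. $c$ is regular if $\pi\in\Theta$ iff every class of $L/\pi$ is $c$-eligible; a regular $c$ is intersection-closed if the family of $c$-eligible sets together with $\emptyset$ is closed under pairwise intersection. Marking procedure: (1) set $M=\emptyset$, $S_0=S$ (current tasks), $U_0=U$ (current users). (2) While the family $\{A(s)\cap U_0: s\in S_0\}$ has no system of distinct representatives: choose $T\subseteq S_0$ with $|\bigcup_{s\in T}A(s)\cap U_0|<|T|$ (the paper writes $U_T=\bigcup_{s\in T}A(s)$), add $U_T$ to $M$, remove $U_T$ from $U_0$, and remove from $S_0$ every task $s$ with $A(s)\subseteq M$. (3) Add to $M$ a system of distinct representatives of the remaining tasks $S_0$ (if any). (4) Discard all users not in $M$. -}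

module Defs where

open import Data.Nat using (ℕ; _<_)
open import Data.Fin using (Fin)
open import Data.Fin.Subset using (Subset; _∈_; _⊆_; _∩_; _∪_; _─_; ∣_∣; Empty)
open import Data.Product using (Σ; _×_)
open import Data.Sum using (_⊎_)
open import Data.List using (List)
open import Data.List.Membership.Propositional using () renaming (_∈_ to _∈ₗ_)
open import Relation.Binary.PropositionalEquality using (_≡_)
open import Relation.Nullary using (¬_)
open import Function.Bundles using (_⇔_)

-- Tasks S = Fin n, users U = Fin m.  Subsets are 'Subset' from Data.Fin.Subset.
-- A function L → U (L ⊆ S) is a dependent function on the members of L.
PartialPlan : (n m : ℕ) → Subset n → Set
PartialPlan n m L = (s : Fin n) → s ∈ L → Fin m

record Constraint (n m : ℕ) : Set₁ where
  field
    scope : Subset n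
    Θ     : PartialPlan n m scope → Set
open Constraint public

module _ {n m : ℕ} where

  restrict : (Fin n → Fin m) → (L : Subset n) → PartialPlan n m L
  restrict π L s _ = π s

  IsClass : (L : Subset n) → PartialPlan n m L → Subset n → Set
  IsClass L π T =
    T ⊆ L × Σ (Fin n) λ s → Σ (s ∈ L) λ p →
      ∀ t (q : t ∈ L) → (t ∈ T ⇔ π t q ≡ π s p)

  Eligible : Constraint n m → Subset n → Set
  Eligible c T = Σ (PartialPlan n m (scope c)) λ π → Θ c π × IsClass (scope c) π T

  Regular : Constraint n m → Set
  Regular c = ∀ π → (Θ c π ⇔ (∀ T → IsClass (scope c) π T → Eligible c T))

  IntersectionClosed : Constraint n m → Set
  IntersectionClosed c =
    Regular c ×
    (∀ T₁ T₂ → Eligible c T₁ → Eligible c T₂ → Eligible c (T₁ ∩ T₂) ⊎ Empty (T₁ ∩ T₂))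

  Valid : (Fin n → Subset m) → List (Constraint n m) → (Fin n → Fin m) → Set₁
  Valid A C π = (∀ s → π s ∈ A s) × (∀ c → c ∈ₗ C → Θ c (restrict π (scope c)))

  -- r is a system of distinct representatives of the family {A(s) ∩ U₀ : s ∈ S₀}
  SDR : (Fin n → Subset m) → (S₀ : Subset n) → Subset m → PartialPlan n m S₀ → Set
  SDR A S₀ U₀ r = (∀ s (p : s ∈ S₀) → r s p ∈ A s × r s p ∈ U₀) ×
                  (∀ s t (p : s ∈ S₀) (q : t ∈ S₀) → r s p ≡ r t q → s ≡ t)

  -- The (nondeterministic) marking procedure as a relation:
  -- Marking A M U₀ S₀ M* : starting from state (M, U₀, S₀), some run ends with marked set M*.
  data Marking (A : Fin n → Subset m) : Subset m → Subset m → Subset n → Subset m → Set where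
    step : ∀ {M U₀ S₀ M*} (T : Subset n) (UT : Subset m) (S₀′ : Subset n) →
           ¬ (Σ (PartialPlan n m S₀) λ r → SDR A S₀ U₀ r) →
           T ⊆ S₀ →
           (∀ u → (u ∈ UT ⇔ Σ (Fin n) λ s → s ∈ T × u ∈ A s)) →
           ∣ UT ∩ U₀ ∣ < ∣ T ∣ →
           (∀ s → (s ∈ S₀′ ⇔ (s ∈ S₀ × ¬ (A s ⊆ (M ∪ UT))))) →
           Marking A (M ∪ UT) (U₀ ─ UT) S₀′ M* →
           Marking A M U₀ S₀ M*
    finish : ∀ {M U₀ S₀} (r : PartialPlan n m S₀) → SDR A S₀ U₀ r →
             (R : Subset m) → (∀ u → (u ∈ R ⇔ Σ (Fin n) λ s → Σ (s ∈ S₀) λ p → r s p ≡ u)) →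
             Marking A M U₀ S₀ (M ∪ R)

module Submission where

-- Only the direction "valid plan ⇒ valid plan inside M" has content.  Take a valid
-- plan π.  Along a run of the marking procedure, the users split into the current
-- users U₀ and the marked users M, and every task whose π-user is still current
-- is a current task.  When the run finishes with an SDR r of the current tasks S₀,
-- reassign every task whose π-user is still current to its representative and
-- leave the others alone.  The new plan π′ is authorised, uses marked users only,
-- and every task either keeps its π-class or becomes a singleton class of π′.

open import Defs
open import Data.Nat using (ℕ)
open import Data.Fin using (Fin)
open import Data.Fin.Subset using (Subset; _∈_; _∉_; ⁅_⁆; ⊥; ⊤; _∪_; _─_; _⊆_; outside)
open import Data.Fin.Subset.Properties
  using (_∈?_; ∉⊥; ∈⊤; x∈⁅x⁆; x∈⁅y⁆⇒x≡y; ⊆-antisym; x∈p∪q⁻; x∈p∪q⁺; x∈p∧x∉q⇒x∈p─q; p─q⊆p)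
open import Data.Product using (Σ; _×_; _,_; proj₁; proj₂)
open import Data.Sum using (_⊎_; inj₁; inj₂)
open import Data.List using (List)
open import Data.List.Membership.Propositional using () renaming (_∈_ to _∈ₗ_)
open import Data.Vec using (_∷_; here; there)
open import Data.Empty using (⊥-elim)
open import Function.Bundles using (_⇔_; mk⇔; Equivalence)
open import Relation.Nullary using (¬_; Dec; yes; no)
open import Relation.Binary.PropositionalEquality using (_≡_; refl; sym; trans; subst)

open Equivalence using (to; from)

x∈p─q⇒x∉q : ∀ {k} {x : Fin k} (p q : Subset k) → x ∈ p ─ q → x ∉ q
x∈p─q⇒x∉q (_ ∷ p) (outside ∷ q) here      ()
x∈p─q⇒x∉q (_ ∷ p) (_ ∷ q)       (there a) (there b) = x∈p─q⇒x∉q p q a b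

module _ {n m : ℕ} where

  KeepsClass : (π π′ : Fin n → Fin m) → Fin n → Set
  KeepsClass π π′ s = ∀ t → (π′ t ≡ π′ s ⇔ π t ≡ π s)

  Isolated : (Fin n → Fin m) → Fin n → Set
  Isolated π′ s = ∀ t → π′ t ≡ π′ s → t ≡ s

  ClassesOrSingletons : (π π′ : Fin n → Fin m) → Set
  ClassesOrSingletons π π′ = ∀ s → KeepsClass π π′ s ⊎ Isolated π′ s

  kept-class : ∀ {π π′ L T} {s : Fin n} → KeepsClass π π′ s →
    (∀ t (q : t ∈ L) → (t ∈ T ⇔ π′ t ≡ π′ s)) →
    (∀ t (q : t ∈ L) → (t ∈ T ⇔ π t ≡ π s))
  kept-class keeps class t q =
    mk⇔ (λ t∈T → to (keeps t) (to (class t q) t∈T))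
        (λ same → from (class t q) (from (keeps t) same))

  isolated-class : ∀ {π′ L T} {s : Fin n} → T ⊆ L → s ∈ L → Isolated π′ s →
    (∀ t (q : t ∈ L) → (t ∈ T ⇔ π′ t ≡ π′ s)) → T ≡ ⁅ s ⁆
  isolated-class {T = T} {s = s} T⊆L s∈L alone class = ⊆-antisym T⊆⁅s⁆ ⁅s⁆⊆T
    where
    T⊆⁅s⁆ : T ⊆ ⁅ s ⁆
    T⊆⁅s⁆ {t} t∈T =
      subst (_∈ ⁅ s ⁆) (sym (alone t (to (class t (T⊆L t∈T)) t∈T))) (x∈⁅x⁆ s)
    ⁅s⁆⊆T : ⁅ s ⁆ ⊆ T
    ⁅s⁆⊆T {t} t∈⁅s⁆ = subst (_∈ T) (sym (x∈⁅y⁆⇒x≡y s t∈⁅s⁆)) (from (class s s∈L) refl)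

  -- Regrouping into classes of π and singletons preserves a regular constraint
  -- whose singletons are eligible: every class of π′ on the scope is eligible.
  regroup-satisfies : (c : Constraint n m) → Regular c →
    (∀ s → s ∈ scope c → Eligible c ⁅ s ⁆) →
    ∀ {π π′} → ClassesOrSingletons π π′ →
    Θ c (restrict π (scope c)) → Θ c (restrict π′ (scope c))
  regroup-satisfies c regular singletons {π} {π′} regroup θπ =
    from (regular (restrict π′ (scope c))) eligible
    where
    eligible : ∀ T → IsClass (scope c) (restrict π′ (scope c)) T → Eligible c T
    eligible T (T⊆L , s , s∈L , class) with regroup s
    ... | inj₁ keeps = restrict π (scope c) , θπ , (T⊆L , s , s∈L , kept-class keeps class)
    ... | inj₂ alone =
      subst (Eligible c) (sym (isolated-class T⊆L s∈L alone class)) (singletons s s∈L)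

  regroup-valid : (A : Fin n → Subset m) (C : List (Constraint n m)) →
    (∀ c → c ∈ₗ C → Regular c) →
    (∀ c → c ∈ₗ C → ∀ s → s ∈ scope c → Eligible c ⁅ s ⁆) →
    ∀ {π π′} → Valid A C π → (∀ s → π′ s ∈ A s) → ClassesOrSingletons π π′ →
    Valid A C π′
  regroup-valid A C regular singletons (_ , satisfied) authorised regroup =
    authorised , λ c c∈C →
      regroup-satisfies c (regular c c∈C) (singletons c c∈C) regroup (satisfied c c∈C)

module MarkingRun {n m : ℕ} (A : Fin n → Subset m) (π : Fin n → Fin m)
                  (π-authorised : ∀ s → π s ∈ A s) where

  record Invariant (M U₀ : Subset m) (S₀ : Subset n) : Set where
    field
      covered  : ∀ u → u ∈ U₀ ⊎ u ∈ M
      disjoint : ∀ u → u ∈ U₀ → u ∉ M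
      pending  : ∀ s → π s ∈ U₀ → s ∈ S₀
  open Invariant

  initial : Invariant ⊥ ⊤ ⊤
  initial = record { covered = λ _ → inj₁ ∈⊤ ; disjoint = λ _ _ → ∉⊥ ; pending = λ _ _ → ∈⊤ }

  -- Step (2) moves U_T from the current to the marked users; a task whose π-user
  -- stays current is not fully covered by the marked users, so it stays current.
  step-invariant : ∀ {M U₀ S₀ S₀′} (UT : Subset m) →
    (∀ s → (s ∈ S₀′ ⇔ (s ∈ S₀ × ¬ (A s ⊆ (M ∪ UT))))) →
    Invariant M U₀ S₀ → Invariant (M ∪ UT) (U₀ ─ UT) S₀′
  step-invariant {M} {U₀} {S₀′ = S₀′} UT S₀′-spec inv = record
    { covered = covered′ ; disjoint = disjoint′ ; pending = pending′ }
    where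
    covered′ : ∀ u → u ∈ U₀ ─ UT ⊎ u ∈ M ∪ UT
    covered′ u with u ∈? UT | covered inv u
    ... | yes u∈UT | _        = inj₂ (x∈p∪q⁺ (inj₂ u∈UT))
    ... | no u∉UT  | inj₁ u∈U₀ = inj₁ (x∈p∧x∉q⇒x∈p─q u∈U₀ u∉UT)
    ... | no _     | inj₂ u∈M  = inj₂ (x∈p∪q⁺ (inj₁ u∈M))
    disjoint′ : ∀ u → u ∈ U₀ ─ UT → u ∉ M ∪ UT
    disjoint′ u u∈U₀′ u∈M′ with x∈p∪q⁻ M UT u∈M′
    ... | inj₁ u∈M  = disjoint inv u (p─q⊆p U₀ UT u∈U₀′) u∈M
    ... | inj₂ u∈UT = x∈p─q⇒x∉q U₀ UT u∈U₀′ u∈UT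
    pending′ : ∀ s → π s ∈ U₀ ─ UT → s ∈ S₀′
    pending′ s πs∈U₀′ = from (S₀′-spec s)
      ( pending inv s (p─q⊆p U₀ UT πs∈U₀′)
      , λ As⊆M′ → disjoint′ (π s) πs∈U₀′ (As⊆M′ (π-authorised s)) )

  Reassignment : Subset m → Set
  Reassignment M* = Σ (Fin n → Fin m) λ π′ →
    (∀ s → π′ s ∈ A s) × (∀ s → π′ s ∈ M*) × ClassesOrSingletons π π′

  module Finish {M U₀ S₀} (inv : Invariant M U₀ S₀)
                (r : PartialPlan n m S₀) (sdr : SDR A S₀ U₀ r) where

    choose : ∀ s → Dec (π s ∈ U₀) → Fin m
    choose s (yes πs∈U₀) = r s (pending inv s πs∈U₀)
    choose s (no _)      = π s

    reassign : Fin n → Fin m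
    reassign s = choose s (π s ∈? U₀)

    reassign-cases : ∀ s →
      (π s ∈ U₀ × Σ (s ∈ S₀) λ p → reassign s ≡ r s p) ⊎ (π s ∉ U₀ × reassign s ≡ π s)
    reassign-cases s with π s ∈? U₀
    ... | yes πs∈U₀ = inj₁ (πs∈U₀ , pending inv s πs∈U₀ , refl)
    ... | no πs∉U₀  = inj₂ (πs∉U₀ , refl)

    moved-current : ∀ {s} (p : s ∈ S₀) → reassign s ≡ r s p → reassign s ∈ U₀
    moved-current p eq = subst (_∈ U₀) (sym eq) (proj₂ (proj₁ sdr _ p))

    authorised : ∀ s → reassign s ∈ A s
    authorised s with reassign-cases s
    ... | inj₁ (_ , p , eq) = subst (_∈ A s) (sym eq) (proj₁ (proj₁ sdr s p))
    ... | inj₂ (_ , eq) = subst (_∈ A s) (sym eq) (π-authorised s)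

    marked : (R : Subset m) → (∀ u → (u ∈ R ⇔ Σ (Fin n) λ s → Σ (s ∈ S₀) λ p → r s p ≡ u)) →
      ∀ s → reassign s ∈ M ∪ R
    marked R R-spec s with reassign-cases s
    ... | inj₁ (_ , p , eq) = x∈p∪q⁺ (inj₂ (from (R-spec _) (s , p , sym eq)))
    ... | inj₂ (πs∉U₀ , eq) with covered inv (π s)
    ...   | inj₁ πs∈U₀ = ⊥-elim (πs∉U₀ πs∈U₀)
    ...   | inj₂ πs∈M  = subst (_∈ M ∪ R) (sym eq) (x∈p∪q⁺ (inj₁ πs∈M))

    -- Moved tasks get distinct current users; the others keep non-current users.
    regroups : ClassesOrSingletons π reassign
    regroups s with reassign-cases s
    ... | inj₁ (_ , p , eq) = inj₂ alone
      where
      alone : Isolated reassign s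
      alone t same with reassign-cases t
      ... | inj₁ (πt∈U₀ , q , eq′) = proj₂ sdr t s q p (trans (sym eq′) (trans same eq))
      ... | inj₂ (πt∉U₀ , eq′) =
        ⊥-elim (πt∉U₀ (subst (_∈ U₀) (trans (sym same) eq′) (moved-current p eq)))
    ... | inj₂ (πs∉U₀ , eq) = inj₁ keeps
      where
      keeps : KeepsClass π reassign s
      keeps t with reassign-cases t
      ... | inj₁ (πt∈U₀ , q , eq′) = mk⇔
        (λ same → ⊥-elim (πs∉U₀ (subst (_∈ U₀) (trans same eq) (moved-current q eq′))))
        (λ same → ⊥-elim (πs∉U₀ (subst (_∈ U₀) same πt∈U₀)))
      ... | inj₂ (_ , eq′) = mk⇔ (λ same → trans (sym eq′) (trans same eq))
                                 (λ same → trans eq′ (trans same (sym eq)))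

  reassignment : ∀ {M U₀ S₀ M*} → Marking A M U₀ S₀ M* → Invariant M U₀ S₀ →
    Reassignment M*
  reassignment (step _ UT _ _ _ _ _ S₀′-spec run) inv =
    reassignment run (step-invariant UT S₀′-spec inv)
  reassignment (finish r sdr R R-spec) inv =
    reassign , authorised , marked R R-spec , regroups
    where open Finish inv r sdr

lemma9 : ∀ {n m} (A : Fin n → Subset m) (C : List (Constraint n m)) →
    (∀ c → c ∈ₗ C → IntersectionClosed c) →
    (∀ c → c ∈ₗ C → ∀ s → s ∈ scope c → Eligible c ⁅ s ⁆) →
    (M : Subset m) → Marking A ⊥ ⊤ ⊤ M →
    ((Σ (Fin n → Fin m) λ π → Valid A C π) ⇔
    (Σ (Fin n → Fin m) λ π → Valid A C π × (∀ s → π s ∈ M)))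
lemma9 A C closed singletons M run = mk⇔ restrict-to-marked forget-marked
  where
  regular : ∀ c → c ∈ₗ C → Regular c
  regular c c∈C = proj₁ (closed c c∈C)

  restrict-to-marked : (Σ _ λ π → Valid A C π) → Σ _ λ π → Valid A C π × (∀ s → π s ∈ M)
  restrict-to-marked (π , valid) with MarkingRun.reassignment A π (proj₁ valid) run
                                                     (MarkingRun.initial A π (proj₁ valid))
  ... | π′ , authorised , marked , regroup =
    π′ , regroup-valid A C regular singletons valid authorised regroup , marked

  forget-marked : (Σ _ λ π → Valid A C π × (∀ s → π s ∈ M)) → Σ _ λ π → Valid A C π
  forget-marked (π , valid , _) = π , valid
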